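{- Let $r \geq 2$, $g \geq 5$, $s \geq 1$ and $n_g$ be integers, and suppose there exists an $(r,g)$-graph $G$ of order $n_g$ containing $s$ vertices at pairwise distance at least $\lceil g/2 \rceil$. Let $k \geq 1$ and $l \geq 1$ be integers and $m > r$ an integer. Then there exists an $(\{r,m\};g)$-graph of order \[ k(n_g - s) + \begin{cases} s & \text{if } m = rk,\\ n_g + s & \text{if } m = rk+1 \text{ and } s \text{ is even},\\ n_g + (l-1)(n_g - s) & \text{if } m = rk + l(r-1),\ s \text{ is even, and } G \text{ contains } s/2 \text{ edges at pairwise distance at least } \lceil g/2 \rceil. \end{cases} \]
   Context: All graphs are finite, simple and undirected. The girth of a graph is the length of its shortest cycle. An $(r,g)$-graph is an $r$-regular graph of girth $g$. For integers $2 \leq r < m$, an $(\{r,m\};g)$-graph is a graph of girth $g$ whose set of vertex degrees is exactly $\{r,m\}$. The distance between a vertex $u$ and an edge $\{v,w\}$ is $\min(\mathrm{dist}(u,v),\mathrm{dist}(u,w))$, and the distance between two edges $\{v_1,w_1\}$ and $\{v_2,w_2\}$ is $\min(\mathrm{dist}(v_1,\{v_2,w_2\}),\mathrm{dist}(w_1,\{v_2,w_2\}))$. -}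

module Defs where

open import Data.Nat using (ℕ; zero; suc; _+_; _*_; _<_; _≤_; ⌈_/2⌉)
open import Data.Bool using (Bool; true; false; if_then_else_)
open import Data.Fin using (Fin; toℕ) renaming (zero to fzero; suc to fsuc)
open import Data.Fin.Properties using ()
open import Data.Product using (Σ; ∃; _×_; _,_)
open import Data.Sum using (_⊎_)
open import Data.List using (List; map; allFin)
open import Data.Nat.ListAction using (sum)
open import Data.Empty using (⊥)
open import Relation.Nullary using (¬_)
open import Relation.Binary.PropositionalEquality using (_≡_; _≢_)

record Graph (n : ℕ) : Set where
  field
    adj     : Fin n → Fin n → Bool
    adj-sym : ∀ u v → adj u v ≡ adj v u
    loopless : ∀ v → adj v v ≡ false
open Graph public

Adj : ∀ {n} → Graph n → Fin n → Fin n → Set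
Adj G u v = adj G u v ≡ true

deg : ∀ {n} → Graph n → Fin n → ℕ
deg {n} G v = sum (map (λ w → if adj G v w then 1 else 0) (allFin n))

cnext : ∀ {ℓ} → Fin ℓ → Fin ℓ
cnext {suc ℓ} i with Data.Fin.toℕ i Data.Nat.<? ℓ
... | Relation.Nullary.yes p = Data.Fin.fromℕ< (Data.Nat.s≤s p)
... | Relation.Nullary.no  _ = fzero

Cycle : ∀ {n} → Graph n → ℕ → Set
Cycle {n} G ℓ =
  3 ≤ ℓ × Σ (Fin ℓ → Fin n) λ c →
    (∀ i j → c i ≡ c j → i ≡ j) × (∀ i → Adj G (c i) (c (cnext i)))

HasGirth : ∀ {n} → Graph n → ℕ → Set
HasGirth G g = Cycle G g × (∀ ℓ → ℓ < g → ¬ Cycle G ℓ)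

Regular : ∀ {n} → Graph n → ℕ → Set
Regular G r = ∀ v → deg G v ≡ r

RGGraph : ∀ {n} → Graph n → ℕ → ℕ → Set
RGGraph G r g = Regular G r × HasGirth G g

DegreeSet₂ : ∀ {n} → Graph n → ℕ → ℕ → Set
DegreeSet₂ G r m =
  (∀ v → deg G v ≡ r ⊎ deg G v ≡ m) × (∃ λ v → deg G v ≡ r) × (∃ λ v → deg G v ≡ m)

BiregGraph : ∀ {n} → Graph n → ℕ → ℕ → ℕ → Set
BiregGraph G r m g = DegreeSet₂ G r m × HasGirth G g

data Walk {n} (G : Graph n) : Fin n → Fin n → ℕ → Set where
  here : ∀ {u} → Walk G u u 0
  step : ∀ {u w v ℓ} → Adj G u w → Walk G w v ℓ → Walk G u v (suc ℓ)

-- dist(u,v) ≥ d  (no walk of length < d; infinite distance allowed)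
DistAtLeast : ∀ {n} → Graph n → Fin n → Fin n → ℕ → Set
DistAtLeast G u v d = ∀ ℓ → ℓ < d → ¬ Walk G u v ℓ

EdgeDistAtLeast : ∀ {n} → Graph n → (Fin n × Fin n) → (Fin n × Fin n) → ℕ → Set
EdgeDistAtLeast G (a , b) (c , e) d =
  DistAtLeast G a c d × DistAtLeast G a e d × DistAtLeast G b c d × DistAtLeast G b e d

HasSpreadVertices : ∀ {n} → Graph n → ℕ → ℕ → Set
HasSpreadVertices {n} G s d =
  Σ (Fin s → Fin n) λ f → ∀ i j → i ≢ j → DistAtLeast G (f i) (f j) d

HasSpreadEdges : ∀ {n} → Graph n → ℕ → ℕ → Set
HasSpreadEdges {n} G t d =
  Σ (Fin t → Fin n × Fin n) λ e →
    (∀ i → Adj G (Data.Product.proj₁ (e i)) (Data.Product.proj₂ (e i))) ×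
    (∀ i j → i ≢ j → EdgeDistAtLeast G (e i) (e j) d)

ExistsBireg : ℕ → ℕ → ℕ → ℕ → Set
ExistsBireg r m g N = Σ (Graph N) λ H → BiregGraph H r m g

{-# OPTIONS --safe #-}
-- A piece is a graph of girth ≥ g with s pairwise non-adjacent attachment vertices of a common
-- degree d, all other vertices of degree r, in which every path between two distinct attachments
-- through non-attachments has length ≥ δ = ⌈g/2⌉. Gluing two pieces along their attachments gives a
-- piece with attachment degree d₁ + d₂: a short cycle would have to lie in one piece, or else meet two
-- distinct attachments and so have length ≥ 2δ ≥ g. An (r,g)-graph G on n vertices yields three
-- pieces: G itself, attached at the s spread vertices (d = r); G minus the s/2 spread edges, attached
-- at their ends (d = r - 1); and G minus the edges y_i u_i, where the y_i are half of the spread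
-- vertices and u_i is a neighbour of y_i, with a pendant attachment hung at each y_i and u_i (d = 1,
-- n + s vertices). Gluing k copies of the first, alone, with the third, or with l copies of the second
-- gives the degrees rk, rk + 1 and rk + l(r - 1). In the last two pieces a deleted edge can only be
-- bypassed by a path of length ≥ g - 1, which is what keeps their attachments far apart.
module Submission where

open import Defs
open import Data.Bool using (Bool; true; false; if_then_else_; _∧_; not)
open import Data.Bool.Properties using (∧-zeroʳ)
open import Data.Empty using (⊥; ⊥-elim)
open import Data.Fin using (Fin; zero; suc; toℕ; fromℕ<; _↑ˡ_; _↑ʳ_; splitAt; join; punchIn; punchOut)
open import Data.Fin.Permutation as Perm using (Permutation; _⟨$⟩ʳ_; _⟨$⟩ˡ_)
open import Data.Fin.Properties
  using (toℕ-fromℕ<; toℕ-injective; toℕ<n; punchInᵢ≢i; punchIn-punchOut; any?; ↑ˡ-injective; ↑ʳ-injective;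
         splitAt-↑ˡ; splitAt-↑ʳ; splitAt⁻¹-↑ˡ; splitAt⁻¹-↑ʳ; splitAt-join; join-splitAt)
  renaming (_≟_ to _≟ᶠ_)
import Data.Fin.Properties as Finₚ
open import Data.List using (map; tabulate)
import Data.Nat.ListAction as List
open import Data.Nat using (ℕ; zero; suc; _+_; _*_; _∸_; _≤_; _<_; _<?_; _≤?_; ⌈_/2⌉; z≤n; s≤s; NonZero)
open import Data.Nat.DivMod
  using (_%_; _/_; m*n/n≡m; m%n<n; m<n⇒m%n≡m; n%n≡0; [m+n]%n≡m%n; %-distribˡ-+; m%n%n≡m%n; m≡m%n+[m/n]*n; /-monoˡ-≤)
open import Data.Nat.Divisibility using (_∣_; divides)
open import Data.Nat.Induction using (<-rec)
open import Data.Nat.Tactic.RingSolver using (solve-∀)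
open import Data.Nat.Properties
open import Algebra.Properties.CommutativeMonoid.Sum +-0-commutativeMonoid
  using (sum-syntax; sum-cong-≗; sum-replicate-zero; sum-remove; ∑-distrib-+; ∑-permute)
open import Data.Product using (Σ; ∃; ∃-syntax; _×_; _,_; proj₁; proj₂)
open import Data.Sum using (_⊎_; inj₁; inj₂; [_,_]′; map₂; swap; reduce)
open import Data.Sum.Properties using (swap-involutive)
open import Data.Unit using (⊤; tt)
open import Function using (_∘_)
open import Function.Definitions using (Injective)
open import Relation.Nullary using (¬_; Dec; yes; no)
open import Relation.Nullary.Decidable using (_×-dec_; ⌊_⌋)
open import Relation.Binary.PropositionalEquality
open import Relation.Binary.Definitions using (tri<; tri≈; tri>)

true≢false : ∀ {A : Set} → true ≡ false → A
true≢false ()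

⟦_⟧ : Bool → ℕ
⟦ b ⟧ = if b then 1 else 0

⟦⟧≢0 : ∀ {b} → ⟦ b ⟧ ≢ 0 → b ≡ true
⟦⟧≢0 {true}  _  = refl
⟦⟧≢0 {false} ≢0 = ⊥-elim (≢0 refl)

∑-zero : ∀ n {h : Fin n → ℕ} → (∀ i → h i ≡ 0) → ∑[ i < n ] h i ≡ 0
∑-zero n h≡0 = trans (sum-cong-≗ h≡0) (sum-replicate-zero n)

∑-single : ∀ {n} (h : Fin n → ℕ) i → h i ≡ 1 → (∀ j → j ≢ i → h j ≡ 0) → ∑[ j < n ] h j ≡ 1
∑-single {suc n} h i hi≡1 h≡0 = begin
  ∑[ j < suc n ] h j                ≡⟨ sum-remove {i = i} h ⟩
  h i + ∑[ j < n ] h (punchIn i j)  ≡⟨ cong₂ _+_ hi≡1 (∑-zero n (λ j → h≡0 _ (punchInᵢ≢i i j))) ⟩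
  1                                 ∎
  where open ≡-Reasoning

∑-split : ∀ m n (h : Fin (m + n) → ℕ) →
          ∑[ i < m + n ] h i ≡ ∑[ i < m ] h (i ↑ˡ n) + ∑[ j < n ] h (m ↑ʳ j)
∑-split zero    n h = refl
∑-split (suc m) n h = trans (cong (h zero +_) (∑-split m n (h ∘ suc))) (sym (+-assoc (h zero) _ _))

∑-nonzero : ∀ {n} (h : Fin n → ℕ) → ∑[ i < n ] h i ≢ 0 → ∃[ i ] h i ≢ 0
∑-nonzero {zero}  h ∑≢0 = ⊥-elim (∑≢0 refl)
∑-nonzero {suc n} h ∑≢0 with h zero ≟ 0
... | no h₀≢0 = zero , h₀≢0
... | yes h₀≡0 with ∑-nonzero (h ∘ suc) (λ ∑≡0 → ∑≢0 (cong₂ _+_ h₀≡0 ∑≡0))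
...   | i , hᵢ≢0 = suc i , hᵢ≢0

listSum-tabulate : ∀ {A : Set} {n} (h : A → ℕ) (f : Fin n → A) →
                   List.sum (map h (tabulate f)) ≡ ∑[ i < n ] h (f i)
listSum-tabulate {n = zero}  h f = refl
listSum-tabulate {n = suc n} h f = cong (h (f zero) +_) (listSum-tabulate h (f ∘ suc))

deg-∑ : ∀ {n} (G : Graph n) v → deg G v ≡ ∑[ w < n ] ⟦ adj G v w ⟧
deg-∑ G v = listSum-tabulate (λ w → ⟦ adj G v w ⟧) (λ w → w)

deg-split : ∀ {s m} (G : Graph (s + m)) v →
            deg G v ≡ ∑[ a < s ] ⟦ adj G v (a ↑ˡ m) ⟧ + ∑[ j < m ] ⟦ adj G v (s ↑ʳ j) ⟧
deg-split {s} {m} G v = trans (deg-∑ G v) (∑-split s m (λ w → ⟦ adj G v w ⟧))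

neighbour : ∀ {n} (G : Graph n) v → deg G v ≢ 0 → ∃[ w ] Adj G v w
neighbour G v deg≢0 with ∑-nonzero (λ w → ⟦ adj G v w ⟧) (deg≢0 ∘ trans (deg-∑ G v))
... | w , ⟦⟧≢0′ = w , ⟦⟧≢0 ⟦⟧≢0′

module _ {n} {G : Graph n} where

  infixr 5 _++ʷ_
  _++ʷ_ : ∀ {u v w a b} → Walk G u v a → Walk G v w b → Walk G u w (a + b)
  here     ++ʷ W′ = W′
  step e W ++ʷ W′ = step e (W ++ʷ W′)

  dist-walk : ∀ {u v d L} → DistAtLeast G u v d → Walk G u v L → d ≤ L
  dist-walk far W = ≮⇒≥ (λ L<d → far _ L<d W)

  dist⇒≢ : ∀ {u v d} → 1 ≤ d → DistAtLeast G u v d → u ≢ v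
  dist⇒≢ 1≤d far refl = far 0 1≤d here

  dist⇒nonadjacent : ∀ {u v d} → 2 ≤ d → DistAtLeast G u v d → adj G u v ≡ false
  dist⇒nonadjacent {u} {v} 2≤d far with adj G u v in e
  ... | false = refl
  ... | true  = ⊥-elim (far 1 2≤d (step e here))

Hom : ∀ {n n′} → Graph n → Graph n′ → (Fin n → Fin n′) → Set
Hom G H f = ∀ {u v} → Adj G u v → Adj H (f u) (f v)

map-walk : ∀ {n n′} {G : Graph n} {H : Graph n′} {f} → Hom G H f →
           ∀ {u v L} → Walk G u v L → Walk H (f u) (f v) L
map-walk hom here       = here
map-walk hom (step e W) = step (hom e) (map-walk hom W)

GirthAtLeast : ∀ {n} → Graph n → ℕ → Set
GirthAtLeast G g = ∀ ℓ → ℓ < g → ¬ Cycle G ℓ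

vertices : ∀ {n} (G : Graph n) {ℓ} → Cycle G ℓ → Fin ℓ → Fin n
vertices G = proj₁ ∘ proj₂

restrict-cycle : ∀ {n n′} {G : Graph n} {H : Graph n′} {P : Fin n → Set} (ρ : ∀ {u} → P u → Fin n′) →
                 (∀ {u v} (p : P u) (q : P v) → ρ p ≡ ρ q → u ≡ v) →
                 (∀ {u v} (p : P u) (q : P v) → Adj G u v → Adj H (ρ p) (ρ q)) →
                 ∀ {ℓ} (C : Cycle G ℓ) → (∀ i → P (vertices G C i)) → Cycle H ℓ
restrict-cycle ρ ρ-inj ρ-adj (3≤ℓ , c , c-inj , c-adj) P-c =
    3≤ℓ , (λ i → ρ (P-c i))
  , (λ i j e → c-inj i j (ρ-inj (P-c i) (P-c j) e))
  , (λ i → ρ-adj (P-c i) (P-c (cnext i)) (c-adj i))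

map-cycle : ∀ {n n′} {G : Graph n} {H : Graph n′} {f} → Injective _≡_ _≡_ f → Hom G H f →
            ∀ {ℓ} → Cycle G ℓ → Cycle H ℓ
map-cycle {G = G} {H} {f} f-inj hom C =
  restrict-cycle {G = G} {H} {P = λ _ → ⊤} (λ {u} _ → f u) (λ _ _ → f-inj) (λ _ _ → hom) C (λ _ → tt)

girth-pullback : ∀ {n n′} {G : Graph n} {H : Graph n′} {f g} → Injective _≡_ _≡_ f → Hom G H f →
                 GirthAtLeast H g → GirthAtLeast G g
girth-pullback {G = G} {H} f-inj hom girth ℓ ℓ<g C = girth ℓ ℓ<g (map-cycle {G = G} {H} f-inj hom C)

toℕ-cnext : ∀ {ℓ} (i : Fin (suc ℓ)) → toℕ (cnext i) ≡ suc (toℕ i) % suc ℓ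
toℕ-cnext {ℓ} i with toℕ i <? ℓ
... | yes i<ℓ = trans (toℕ-fromℕ< (s≤s i<ℓ)) (sym (m<n⇒m%n≡m (s≤s i<ℓ)))
... | no  i≮ℓ = trans (sym (n%n≡0 (suc ℓ))) (cong (λ k → suc k % suc ℓ) (sym i≡ℓ))
  where
  i≡ℓ : toℕ i ≡ ℓ
  i≡ℓ = ≤-antisym (≤-pred (toℕ<n i)) (≮⇒≥ i≮ℓ)

suc-% : ∀ t n .{{_ : NonZero n}} → suc t % n ≡ suc (t % n) % n
suc-% t n = begin
  (1 + t) % n                  ≡⟨ %-distribˡ-+ 1 t n ⟩
  (1 % n + t % n) % n          ≡⟨ cong (λ k → (1 % n + k) % n) (m%n%n≡m%n t n) ⟨
  (1 % n + t % n % n) % n      ≡⟨ %-distribˡ-+ 1 (t % n) n ⟨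
  (1 + t % n) % n              ∎
  where open ≡-Reasoning

%-window : ∀ {a b} n .{{_ : NonZero n}} → a < b → b < a + n → a % n ≢ b % n
%-window {a} {b} n a<b b<a+n a%≡b% with a / n ≟ b / n
... | yes a/≡b/ = <⇒≢ a<b (begin
  a                   ≡⟨ m≡m%n+[m/n]*n a n ⟩
  a % n + a / n * n   ≡⟨ cong₂ (λ x y → x + y * n) a%≡b% a/≡b/ ⟩
  b % n + b / n * n   ≡⟨ m≡m%n+[m/n]*n b n ⟨
  b                   ∎)
  where open ≡-Reasoning
... | no a/≢b/ = <⇒≱ b<a+n (begin
  a + n                    ≡⟨ cong (_+ n) (m≡m%n+[m/n]*n a n) ⟩
  a % n + a / n * n + n    ≡⟨ +-assoc (a % n) _ n ⟩
  a % n + (a / n * n + n)  ≡⟨ cong (a % n +_) (+-comm (a / n * n) n) ⟩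
  a % n + suc (a / n) * n  ≤⟨ +-mono-≤ (≤-reflexive a%≡b%) (*-monoˡ-≤ n a/<b/) ⟩
  b % n + b / n * n        ≡⟨ m≡m%n+[m/n]*n b n ⟨
  b                        ∎)
  where
  open ≤-Reasoning
  a/<b/ : a / n < b / n
  a/<b/ = ≤∧≢⇒< (/-monoˡ-≤ n (<⇒≤ a<b)) a/≢b/

arcs-sum : ∀ {a b n} → a ≤ b → b ≤ a + n → (b ∸ a) + (a + n ∸ b) ≡ n
arcs-sum {a} {b} {n} a≤b b≤a+n = begin
  (b ∸ a) + (a + n ∸ b)            ≡⟨ cong (λ k → (b ∸ a) + (a + n ∸ k)) (m+[n∸m]≡n a≤b) ⟨
  (b ∸ a) + (a + n ∸ (a + (b ∸ a))) ≡⟨ cong ((b ∸ a) +_) ([m+n]∸[m+o]≡n∸o a n (b ∸ a)) ⟩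
  (b ∸ a) + (n ∸ (b ∸ a))
    ≡⟨ m+[n∸m]≡n (subst (b ∸ a ≤_) (m+n∸m≡n a n) (∸-monoˡ-≤ a b≤a+n)) ⟩
  n                                ∎
  where open ≡-Reasoning

module Unrolled {n} (G : Graph n) {ℓ′} (C : Cycle G (suc ℓ′)) where

  c-injective : ∀ i j → vertices G C i ≡ vertices G C j → i ≡ j
  c-injective = proj₁ (proj₂ (proj₂ C))

  c-adj : ∀ i → Adj G (vertices G C i) (vertices G C (cnext i))
  c-adj = proj₂ (proj₂ (proj₂ C))

  position : ℕ → Fin (suc ℓ′)
  position t = fromℕ< (m%n<n t (suc ℓ′))

  toℕ-position : ∀ t → toℕ (position t) ≡ t % suc ℓ′
  toℕ-position t = toℕ-fromℕ< (m%n<n t (suc ℓ′))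

  at : ℕ → Fin n
  at t = vertices G C (position t)

  at-adj : ∀ t → Adj G (at t) (at (suc t))
  at-adj t = subst (λ i → Adj G (at t) (vertices G C i)) cnext-position (c-adj (position t))
    where
    cnext-position : cnext (position t) ≡ position (suc t)
    cnext-position = toℕ-injective (begin
      toℕ (cnext (position t))         ≡⟨ toℕ-cnext (position t) ⟩
      suc (toℕ (position t)) % suc ℓ′  ≡⟨ cong (λ k → suc k % suc ℓ′) (toℕ-position t) ⟩
      suc (t % suc ℓ′) % suc ℓ′        ≡⟨ suc-% t (suc ℓ′) ⟨
      suc t % suc ℓ′                   ≡⟨ toℕ-position (suc t) ⟨
      toℕ (position (suc t))           ∎)
      where open ≡-Reasoning

  at-periodic : ∀ t → at (t + suc ℓ′) ≡ at t
  at-periodic t = cong (vertices G C) (toℕ-injective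
    (trans (toℕ-position (t + suc ℓ′)) (trans ([m+n]%n≡m%n t (suc ℓ′)) (sym (toℕ-position t)))))

  at-toℕ : ∀ i → at (toℕ i) ≡ vertices G C i
  at-toℕ i = cong (vertices G C) (toℕ-injective (trans (toℕ-position (toℕ i)) (m<n⇒m%n≡m (toℕ<n i))))

  at-injective : ∀ {a b} → a < b → b < a + suc ℓ′ → at a ≢ at b
  at-injective {a} {b} a<b b<a+ℓ at≡ = %-window (suc ℓ′) a<b b<a+ℓ
    (trans (sym (toℕ-position a)) (trans (cong toℕ (c-injective _ _ at≡)) (toℕ-position b)))

  walk-forward : ∀ t d → Walk G (at t) (at (d + t)) d
  walk-forward t zero    = here
  walk-forward t (suc d) =
    step (at-adj t) (subst (λ k → Walk G (at (suc t)) (at k) d) (+-suc d t) (walk-forward (suc t) d))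

  arc : ∀ {a b} → a ≤ b → Walk G (at a) (at b) (b ∸ a)
  arc {a} {b} a≤b = subst (λ k → Walk G (at a) (at k) (b ∸ a)) (m∸n+n≡m a≤b) (walk-forward a (b ∸ a))

leaf-not-on-cycle : ∀ {n} (G : Graph n) {ℓ} (C : Cycle G ℓ) i →
                    (∀ {w w′} → Adj G (vertices G C i) w → Adj G (vertices G C i) w′ → w ≡ w′) → ⊥
leaf-not-on-cycle G {suc ℓ′} C i unique =
  at-injective suc-t<t+ℓ′ (s≤s (+-monoʳ-≤ t (n≤1+n ℓ′)))
    (unique (subst (λ x → Adj G x (at (suc t))) (at-toℕ i) (at-adj t))
            (subst (λ x → Adj G x (at (t + ℓ′))) (at-toℕ i) before))
  where
  open Unrolled G C
  t = toℕ i
  before : Adj G (at t) (at (t + ℓ′))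
  before = trans (adj-sym G _ _)
    (subst (Adj G (at (t + ℓ′))) (trans (cong at (sym (+-suc t ℓ′))) (at-periodic t)) (at-adj (t + ℓ′)))
  suc-t<t+ℓ′ : suc t < t + ℓ′
  suc-t<t+ℓ′ = subst (_≤ t + ℓ′) (+-comm t 2) (+-monoʳ-≤ t (≤-pred (proj₁ C)))

-- Bypassing a deleted edge

module _ {n} {G : Graph n} where

  vertexAt : ∀ {u v L} → Walk G u v L → ℕ → Fin n
  vertexAt {u = u} here       _       = u
  vertexAt {u = u} (step _ _) zero    = u
  vertexAt         (step _ W) (suc i) = vertexAt W i

  vertexAt-start : ∀ {u v L} (W : Walk G u v L) → vertexAt W 0 ≡ u
  vertexAt-start here       = refl
  vertexAt-start (step _ _) = refl

  vertexAt-end : ∀ {u v L} (W : Walk G u v L) → vertexAt W L ≡ v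
  vertexAt-end here       = refl
  vertexAt-end (step _ W) = vertexAt-end W

  vertexAt-adj : ∀ {u v L} (W : Walk G u v L) {i} → i < L → Adj G (vertexAt W i) (vertexAt W (suc i))
  vertexAt-adj (step e W) {zero}  _         = subst (Adj G _) (sym (vertexAt-start W)) e
  vertexAt-adj (step e W) {suc i} (s≤s i<L) = vertexAt-adj W i<L

  prefix : ∀ {u v L} (W : Walk G u v L) {i} → i ≤ L → Walk G u (vertexAt W i) i
  prefix here       {zero}  _         = here
  prefix (step e W) {zero}  _         = here
  prefix (step e W) {suc i} (s≤s i≤L) = step e (prefix W i≤L)

  suffix : ∀ {u v L} (W : Walk G u v L) {j} → j ≤ L → Walk G (vertexAt W j) v (L ∸ j)
  suffix here       {zero}  _         = here
  suffix (step e W) {zero}  _         = step e W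
  suffix (step e W) {suc j} (s≤s j≤L) = suffix W j≤L

  shortcut : ∀ {u v L} (W : Walk G u v L) {i j} → i < j → j ≤ L → vertexAt W i ≡ vertexAt W j →
             Walk G u v (i + (L ∸ j))
  shortcut {v = v} W i<j j≤L same =
    prefix W (≤-trans (<⇒≤ i<j) j≤L) ++ʷ subst (λ x → Walk G x v _) (sym same) (suffix W j≤L)

module Bypass {n} {G G′ : Graph n} {g} (girth : GirthAtLeast G g) (G′⊆G : Hom G′ G (λ v → v))
                    {u v} (uv : Adj G u v) (uv∉G′ : adj G′ u v ≡ false) where

  -- A bypass without repeated vertices closes a cycle with the deleted edge; otherwise shortcut it.
  Repeats : ∀ {L} → Walk G′ u v L → Set
  Repeats {L} W = ∃ λ (i : Fin (suc L)) → ∃ λ (j : Fin (suc L)) →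
                  toℕ i < toℕ j × vertexAt W (toℕ i) ≡ vertexAt W (toℕ j)

  repeats? : ∀ {L} (W : Walk G′ u v L) → Dec (Repeats W)
  repeats? W = any? λ i → any? λ j → (toℕ i <? toℕ j) ×-dec (vertexAt W (toℕ i) ≟ᶠ vertexAt W (toℕ j))

  path-cycle : ∀ {L} (W : Walk G′ u v L) → ¬ Repeats W → 2 ≤ L → Cycle G (suc L)
  path-cycle {L} W simple 2≤L = s≤s 2≤L , c , c-inj , c-adj
    where
    c : Fin (suc L) → Fin n
    c k = vertexAt W (toℕ k)
    c-inj : ∀ k k′ → c k ≡ c k′ → k ≡ k′
    c-inj k k′ same with <-cmp (toℕ k) (toℕ k′)
    ... | tri< k<k′ _ _ = ⊥-elim (simple (k , k′ , k<k′ , same))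
    ... | tri≈ _ k≡k′ _ = toℕ-injective k≡k′
    ... | tri> _ _ k′<k = ⊥-elim (simple (k′ , k , k′<k , sym same))
    c-adj : ∀ k → Adj G (c k) (c (cnext k))
    c-adj k with toℕ k <? L
    ... | yes k<L =
      G′⊆G (subst (λ x → Adj G′ (c k) (vertexAt W x)) (sym (toℕ-fromℕ< (s≤s k<L))) (vertexAt-adj W k<L))
    ... | no  k≮L = subst₂ (Adj G) (sym (trans (cong (vertexAt W) k≡L) (vertexAt-end W))) (sym (vertexAt-start W))
                      (trans (adj-sym G v u) uv)
      where
      k≡L : toℕ k ≡ L
      k≡L = ≤-antisym (≤-pred (toℕ<n k)) (≮⇒≥ k≮L)

  bypass-long : ∀ {L} → Walk G′ u v L → g ≤ suc L
  bypass-long {L} = <-rec (λ L → Walk G′ u v L → g ≤ suc L) long L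
    where
    long : ∀ L → (∀ {L′} → L′ < L → Walk G′ u v L′ → g ≤ suc L′) → Walk G′ u v L → g ≤ suc L
    long L shorter W with repeats? W
    ... | yes (i , j , i<j , same) =
      ≤-trans (shorter shorter-by (shortcut W i<j j≤L same)) (s≤s (<⇒≤ shorter-by))
      where
      j≤L = ≤-pred (toℕ<n j)
      shorter-by : toℕ i + (L ∸ toℕ j) < L
      shorter-by = subst (toℕ i + (L ∸ toℕ j) <_) (m+[n∸m]≡n j≤L) (+-monoˡ-< (L ∸ toℕ j) i<j)
    long .0 shorter here          | no _ = true≢false (trans (sym uv) (loopless G u))
    long .1 shorter (step e here) | no _ = true≢false (trans (sym e) uv∉G′)
    long L shorter W@(step _ (step _ _)) | no simple =
      ≮⇒≥ (λ L<g → girth _ L<g (path-cycle W simple (s≤s (s≤s z≤n))))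

Extension : ∀ {s n} → (Fin s → Fin n) → Set
Extension {s} {n} φ = ∃ λ m → Σ (Permutation (s + m) n) λ π → ∀ a → π ⟨$⟩ʳ (a ↑ˡ m) ≡ φ a

extend : ∀ {s n} (φ : Fin s → Fin n) → Injective _≡_ _≡_ φ → Extension φ
extend {zero}          φ φ-inj = _ , Perm.id , λ ()
extend {suc s} {zero}  φ φ-inj with φ zero
... | ()
extend {suc s} {suc n} φ φ-inj = extend-by (extend φ′ φ′-inj)
  where
  φ₀≢ : ∀ a → φ zero ≢ φ (suc a)
  φ₀≢ a same with φ-inj same
  ... | ()
  φ′ : Fin s → Fin n
  φ′ a = punchOut (φ₀≢ a)
  φ′-inj : Injective _≡_ _≡_ φ′
  φ′-inj {a} {b} same = Finₚ.suc-injective (φ-inj (begin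
    φ (suc a)                   ≡⟨ punchIn-punchOut (φ₀≢ a) ⟨
    punchIn (φ zero) (φ′ a)     ≡⟨ cong (punchIn (φ zero)) same ⟩
    punchIn (φ zero) (φ′ b)     ≡⟨ punchIn-punchOut (φ₀≢ b) ⟩
    φ (suc b)                   ∎))
    where open ≡-Reasoning
  extend-by : Extension φ′ → Extension φ
  extend-by (m , π , π-ext) = m , Perm.insert zero (φ zero) π , ext
    where
    ext : ∀ a → Perm.insert zero (φ zero) π ⟨$⟩ʳ (a ↑ˡ m) ≡ φ a
    ext zero    = refl
    ext (suc a) = begin
      Perm.insert zero (φ zero) π ⟨$⟩ʳ punchIn zero (a ↑ˡ m)
        ≡⟨ Perm.insert-punchIn zero (φ zero) π (a ↑ˡ m) ⟩
      punchIn (φ zero) (π ⟨$⟩ʳ (a ↑ˡ m))                    ≡⟨ cong (punchIn (φ zero)) (π-ext a) ⟩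
      punchIn (φ zero) (φ′ a)                               ≡⟨ punchIn-punchOut (φ₀≢ a) ⟩
      φ (suc a)                                             ∎
      where open ≡-Reasoning

module _ {n′ n} (π : Permutation n′ n) where

  relabel : Graph n → Graph n′
  relabel G = record
    { adj      = λ u v → adj G (π ⟨$⟩ʳ u) (π ⟨$⟩ʳ v)
    ; adj-sym  = λ u v → adj-sym G (π ⟨$⟩ʳ u) (π ⟨$⟩ʳ v)
    ; loopless = λ v → loopless G (π ⟨$⟩ʳ v)
    }

  permutation-injective : Injective _≡_ _≡_ (π ⟨$⟩ʳ_)
  permutation-injective {x} {y} same =
    trans (sym (Perm.inverseˡ π)) (trans (cong (π ⟨$⟩ˡ_) same) (Perm.inverseˡ π))

  relabel-hom : ∀ G → Hom (relabel G) G (π ⟨$⟩ʳ_)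
  relabel-hom G e = e

  relabel-hom⁻¹ : ∀ G → Hom G (relabel G) (π ⟨$⟩ˡ_)
  relabel-hom⁻¹ G = subst₂ (Adj G) (sym (Perm.inverseʳ π)) (sym (Perm.inverseʳ π))

  deg-relabel : ∀ G u → deg (relabel G) u ≡ deg G (π ⟨$⟩ʳ u)
  deg-relabel G u = begin
    deg (relabel G) u                          ≡⟨ deg-∑ (relabel G) u ⟩
    ∑[ w < n′ ] ⟦ adj G (π ⟨$⟩ʳ u) (π ⟨$⟩ʳ w) ⟧ ≡⟨ ∑-permute (λ w → ⟦ adj G (π ⟨$⟩ʳ u) w ⟧) π ⟨
    ∑[ w < n ] ⟦ adj G (π ⟨$⟩ʳ u) w ⟧          ≡⟨ deg-∑ G (π ⟨$⟩ʳ u) ⟨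
    deg G (π ⟨$⟩ʳ u)                           ∎
    where open ≡-Reasoning

-- Pieces and gluing

↑ˡ≢↑ʳ : ∀ {s m} {a : Fin s} {j : Fin m} → a ↑ˡ m ≢ s ↑ʳ j
↑ˡ≢↑ʳ {s} {m} {a} {j} same
  with trans (sym (splitAt-↑ˡ s a m)) (trans (cong (splitAt s) same) (splitAt-↑ʳ s m j))
... | ()

data Split {s m} : Fin (s + m) → Set where
  attach : ∀ a → Split (a ↑ˡ m)
  inside : ∀ j → Split (s ↑ʳ j)

split : ∀ {s m} (u : Fin (s + m)) → Split {s} {m} u
split {s} u with splitAt s u in split-u
... | inj₁ a = subst Split (splitAt⁻¹-↑ˡ split-u) (attach a)
... | inj₂ j = subst Split (splitAt⁻¹-↑ʳ split-u) (inside j)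

data InnerWalk {m} (s : ℕ) (G : Graph (s + m)) : Fin (s + m) → Fin (s + m) → ℕ → Set where
  edge : ∀ {u v} → Adj G u v → InnerWalk s G u v 1
  via  : ∀ {u j v L} → Adj G u (s ↑ʳ j) → InnerWalk s G (s ↑ʳ j) v L → InnerWalk s G u v (suc L)

inner-walk : ∀ {s m} {G : Graph (s + m)} {u v L} → InnerWalk s G u v L → Walk G u v L
inner-walk (edge e)   = step e here
inner-walk (via e iw) = step e (inner-walk iw)

record Piece (s r g δ : ℕ) : Set where
  field
    inner              : ℕ
    graph              : Graph (s + inner)
    attachDeg          : ℕ
    attach-independent : ∀ a b → adj graph (a ↑ˡ inner) (b ↑ˡ inner) ≡ false
    deg-attach         : ∀ a → deg graph (a ↑ˡ inner) ≡ attachDeg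
    deg-inner          : ∀ j → deg graph (s ↑ʳ j) ≡ r
    girth              : GirthAtLeast graph g
    attach-far         : ∀ {a b L} → a ≢ b → InnerWalk s graph (a ↑ˡ inner) (b ↑ˡ inner) L → δ ≤ L

  attachDeg-inner : ∀ a → attachDeg ≡ ∑[ j < inner ] ⟦ adj graph (a ↑ˡ inner) (s ↑ʳ j) ⟧
  attachDeg-inner a = begin
    attachDeg                   ≡⟨ deg-attach a ⟨
    deg graph (a ↑ˡ inner)      ≡⟨ deg-split {s} graph (a ↑ˡ inner) ⟩
    ∑[ b < s ] ⟦ adj graph (a ↑ˡ inner) (b ↑ˡ inner) ⟧ + ∑[ j < inner ] ⟦ adj graph (a ↑ˡ inner) (s ↑ʳ j) ⟧
        ≡⟨ cong (_+ ∑[ j < inner ] ⟦ adj graph (a ↑ˡ inner) (s ↑ʳ j) ⟧)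
                (∑-zero s (λ b → cong ⟦_⟧ (attach-independent a b))) ⟩
    ∑[ j < inner ] ⟦ adj graph (a ↑ˡ inner) (s ↑ʳ j) ⟧ ∎
    where open ≡-Reasoning

  inner-neighbour : ∀ a → attachDeg ≢ 0 → Fin inner
  inner-neighbour a d≢0 with neighbour graph (a ↑ˡ inner) (d≢0 ∘ trans (sym (deg-attach a)))
  ... | w , e with split {s} {inner} w
  ...   | attach b = true≢false (trans (sym e) (attach-independent a b))
  ...   | inside j = j

data Side : Set where
  left right : Side

other : Side → Side
other left  = right
other right = left

module Gluing {s r g δ} (g≤δ+δ : g ≤ δ + δ) (P₁ P₂ : Piece s r g δ) where

  piece : Side → Piece s r g δ
  piece left  = P₁
  piece right = P₂

  m : Side → ℕ
  m σ = Piece.inner (piece σ)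

  Q : ∀ σ → Graph (s + m σ)
  Q σ = Piece.graph (piece σ)

  N : ℕ
  N = s + (m left + m right)

  data Label : Set where
    attachment : Fin s → Label
    inner      : ∀ σ → Fin (m σ) → Label

  label : Fin N → Label
  label u = [ attachment , [ inner left , inner right ]′ ∘ splitAt (m left) ]′ (splitAt s u)

  vertex : Label → Fin N
  vertex (attachment a)  = a ↑ˡ (m left + m right)
  vertex (inner left j)  = s ↑ʳ (j ↑ˡ m right)
  vertex (inner right j) = s ↑ʳ (m left ↑ʳ j)

  label-vertex : ∀ l → label (vertex l) ≡ l
  label-vertex (attachment a)  rewrite splitAt-↑ˡ s a (m left + m right) = refl
  label-vertex (inner left j)  rewrite splitAt-↑ʳ s (m left + m right) (j ↑ˡ m right)
                                     | splitAt-↑ˡ (m left) j (m right) = refl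
  label-vertex (inner right j) rewrite splitAt-↑ʳ s (m left + m right) (m left ↑ʳ j)
                                     | splitAt-↑ʳ (m left) (m right) j = refl

  vertex-label : ∀ u → vertex (label u) ≡ u
  vertex-label u with splitAt s u in split-u
  ... | inj₁ a = splitAt⁻¹-↑ˡ split-u
  ... | inj₂ j with splitAt (m left) j in split-j
  ...   | inj₁ j₁ = trans (cong (s ↑ʳ_) (splitAt⁻¹-↑ˡ split-j)) (splitAt⁻¹-↑ʳ split-u)
  ...   | inj₂ j₂ = trans (cong (s ↑ʳ_) (splitAt⁻¹-↑ʳ split-j)) (splitAt⁻¹-↑ʳ split-u)

  label-injective : Injective _≡_ _≡_ label
  label-injective {u} {v} same = trans (sym (vertex-label u)) (trans (cong vertex same) (vertex-label v))

  adjL : Label → Label → Bool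
  adjL (attachment a)  (attachment b)   = false
  adjL (attachment a)  (inner σ j)      = adj (Q σ) (a ↑ˡ m σ) (s ↑ʳ j)
  adjL (inner σ j)     (attachment a)   = adj (Q σ) (s ↑ʳ j) (a ↑ˡ m σ)
  adjL (inner left j)  (inner left j′)  = adj (Q left) (s ↑ʳ j) (s ↑ʳ j′)
  adjL (inner right j) (inner right j′) = adj (Q right) (s ↑ʳ j) (s ↑ʳ j′)
  adjL (inner left _)  (inner right _)  = false
  adjL (inner right _) (inner left _)   = false

  adjL-sym : ∀ l l′ → adjL l l′ ≡ adjL l′ l
  adjL-sym (attachment a)  (attachment b)   = refl
  adjL-sym (attachment a)  (inner σ j)      = adj-sym (Q σ) _ _
  adjL-sym (inner σ j)     (attachment a)   = adj-sym (Q σ) _ _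
  adjL-sym (inner left j)  (inner left j′)  = adj-sym (Q left) _ _
  adjL-sym (inner right j) (inner right j′) = adj-sym (Q right) _ _
  adjL-sym (inner left _)  (inner right _)  = refl
  adjL-sym (inner right _) (inner left _)   = refl

  adjL-irrefl : ∀ l → adjL l l ≡ false
  adjL-irrefl (attachment a)  = refl
  adjL-irrefl (inner left j)  = loopless (Q left) _
  adjL-irrefl (inner right j) = loopless (Q right) _

  H : Graph N
  H = record
    { adj      = λ u v → adjL (label u) (label v)
    ; adj-sym  = λ u v → adjL-sym (label u) (label v)
    ; loopless = λ v → adjL-irrefl (label v)
    }

  adj-vertex : ∀ l l′ → adj H (vertex l) (vertex l′) ≡ adjL l l′
  adj-vertex l l′ = cong₂ adjL (label-vertex l) (label-vertex l′)

  deg-vertex : ∀ l → deg H (vertex l) ≡ ∑[ a < s ] ⟦ adjL l (attachment a) ⟧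
                                         + (∑[ j < m left ] ⟦ adjL l (inner left j) ⟧
                                            + ∑[ j < m right ] ⟦ adjL l (inner right j) ⟧)
  deg-vertex l = begin
    deg H (vertex l)
      ≡⟨ deg-split {s} H (vertex l) ⟩
    ∑[ a < s ] ⟦ adj H (vertex l) (vertex (attachment a)) ⟧
      + ∑[ j < m left + m right ] ⟦ adj H (vertex l) (s ↑ʳ j) ⟧
      ≡⟨ cong (∑[ a < s ] ⟦ adj H (vertex l) (vertex (attachment a)) ⟧ +_) (∑-split (m left) (m right) _) ⟩
    ∑[ a < s ] ⟦ adj H (vertex l) (vertex (attachment a)) ⟧
      + (∑[ j < m left ] ⟦ adj H (vertex l) (vertex (inner left j)) ⟧
         + ∑[ j < m right ] ⟦ adj H (vertex l) (vertex (inner right j)) ⟧)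
      ≡⟨ cong₂ _+_ (sum-cong-≗ {s} (λ a → cong ⟦_⟧ (adj-vertex l (attachment a))))
                   (cong₂ _+_ (sum-cong-≗ {m left} (λ j → cong ⟦_⟧ (adj-vertex l (inner left j))))
                              (sum-cong-≗ {m right} (λ j → cong ⟦_⟧ (adj-vertex l (inner right j))))) ⟩
    ∑[ a < s ] ⟦ adjL l (attachment a) ⟧
      + (∑[ j < m left ] ⟦ adjL l (inner left j) ⟧ + ∑[ j < m right ] ⟦ adjL l (inner right j) ⟧) ∎
    where open ≡-Reasoning

  deg-attachment : ∀ a → deg H (vertex (attachment a)) ≡ Piece.attachDeg P₁ + Piece.attachDeg P₂
  deg-attachment a = begin
    deg H (vertex (attachment a))
      ≡⟨ deg-vertex (attachment a) ⟩
    ∑[ b < s ] 0 + (∑[ j < m left ] ⟦ adj (Q left) (a ↑ˡ m left) (s ↑ʳ j) ⟧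
                    + ∑[ j < m right ] ⟦ adj (Q right) (a ↑ˡ m right) (s ↑ʳ j) ⟧)
      ≡⟨ cong (_+ (∑[ j < m left ] ⟦ adj (Q left) (a ↑ˡ m left) (s ↑ʳ j) ⟧
                    + ∑[ j < m right ] ⟦ adj (Q right) (a ↑ˡ m right) (s ↑ʳ j) ⟧)) (∑-zero s (λ _ → refl)) ⟩
    ∑[ j < m left ] ⟦ adj (Q left) (a ↑ˡ m left) (s ↑ʳ j) ⟧
      + ∑[ j < m right ] ⟦ adj (Q right) (a ↑ˡ m right) (s ↑ʳ j) ⟧
      ≡⟨ cong₂ _+_ (Piece.attachDeg-inner P₁ a) (Piece.attachDeg-inner P₂ a) ⟨
    Piece.attachDeg P₁ + Piece.attachDeg P₂ ∎
    where open ≡-Reasoning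

  deg-inner-vertex : ∀ σ j → deg H (vertex (inner σ j)) ≡ r
  deg-inner-vertex left j = begin
    deg H (vertex (inner left j))  ≡⟨ deg-vertex (inner left j) ⟩
    X + (I + ∑[ j′ < m right ] 0)   ≡⟨ cong (λ k → X + (I + k)) (∑-zero (m right) (λ _ → refl)) ⟩
    X + (I + 0)                    ≡⟨ cong (X +_) (+-identityʳ I) ⟩
    X + I                          ≡⟨ deg-split {s} (Q left) (s ↑ʳ j) ⟨
    deg (Q left) (s ↑ʳ j)          ≡⟨ Piece.deg-inner P₁ j ⟩
    r                              ∎
    where
    open ≡-Reasoning
    X = ∑[ a < s ] ⟦ adj (Q left) (s ↑ʳ j) (a ↑ˡ m left) ⟧
    I = ∑[ j′ < m left ] ⟦ adj (Q left) (s ↑ʳ j) (s ↑ʳ j′) ⟧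
  deg-inner-vertex right j = begin
    deg H (vertex (inner right j))  ≡⟨ deg-vertex (inner right j) ⟩
    X + (∑[ j′ < m left ] 0 + I)     ≡⟨ cong (λ k → X + (k + I)) (∑-zero (m left) (λ _ → refl)) ⟩
    X + I                           ≡⟨ deg-split {s} (Q right) (s ↑ʳ j) ⟨
    deg (Q right) (s ↑ʳ j)          ≡⟨ Piece.deg-inner P₂ j ⟩
    r                               ∎
    where
    open ≡-Reasoning
    X = ∑[ a < s ] ⟦ adj (Q right) (s ↑ʳ j) (a ↑ˡ m right) ⟧
    I = ∑[ j′ < m right ] ⟦ adj (Q right) (s ↑ʳ j) (s ↑ʳ j′) ⟧

  deg-inner : ∀ j → deg H (s ↑ʳ j) ≡ r
  deg-inner j with split {m left} {m right} j
  ... | attach j₁ = deg-inner-vertex left j₁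
  ... | inside j₂ = deg-inner-vertex right j₂

  data LWalk : Label → Label → ℕ → Set where
    here : ∀ {l} → LWalk l l 0
    step : ∀ {l l′ l″ L} → adjL l l′ ≡ true → LWalk l′ l″ L → LWalk l l″ (suc L)

  label-walk : ∀ {u v L} → Walk H u v L → LWalk (label u) (label v) L
  label-walk here       = here
  label-walk (step e W) = step e (label-walk W)

  -- Entering piece σ, a walk returns to some attachment c through inner vertices of σ;
  -- unless c is the final attachment b, the rest of the walk is at least δ long.
  data Excursion (σ : Side) (j : Fin (m σ)) (b : Fin s) (L : ℕ) : Set where
    returns : ∀ c {L₁} → InnerWalk s (Q σ) (s ↑ʳ j) (c ↑ˡ m σ) L₁ → L₁ ≤ L → c ≡ b ⊎ δ + L₁ ≤ L →
              Excursion σ j b L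

  continue : ∀ {σ j j′ b L} → Adj (Q σ) (s ↑ʳ j) (s ↑ʳ j′) → Excursion σ j′ b L → Excursion σ j b (suc L)
  continue {L = L} e (returns c {L₁} iw L₁≤L ends) =
    returns c (via e iw) (s≤s L₁≤L) (map₂ (λ long → subst (_≤ suc L) (sym (+-suc δ L₁)) (s≤s long)) ends)

  attachments-far : ∀ {a b L} → a ≢ b → LWalk (attachment a) (attachment b) L → δ ≤ L
  excursion : ∀ {σ j b L} → LWalk (inner σ j) (attachment b) L → Excursion σ j b L

  attachments-far a≢b here = ⊥-elim (a≢b refl)
  attachments-far a≢b (step {l′ = attachment c} () W)
  attachments-far {a} a≢b (step {l′ = inner σ j} e W) with excursion W
  ... | returns c iw L₁≤L ends with c ≟ᶠ a
  ...   | no c≢a   = ≤-trans (Piece.attach-far (piece σ) (c≢a ∘ sym) (via e iw)) (s≤s L₁≤L)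
  ...   | yes refl = [ (λ a≡b → ⊥-elim (a≢b a≡b)) , (λ long → ≤-trans (m≤m+n δ _) (m≤n⇒m≤1+n long)) ]′ ends

  excursion {b = b} (step {l′ = attachment c} {L = L} e W) with c ≟ᶠ b
  ... | yes c≡b = returns c (edge e) (s≤s z≤n) (inj₁ c≡b)
  ... | no c≢b  =
    returns c (edge e) (s≤s z≤n) (inj₂ (subst (_≤ suc L) (+-comm 1 δ) (s≤s (attachments-far c≢b W))))
  excursion {left}  (step {l′ = inner left _}  e W) = continue e (excursion W)
  excursion {right} (step {l′ = inner right _} e W) = continue e (excursion W)
  excursion {left}  (step {l′ = inner right _} () W)
  excursion {right} (step {l′ = inner left _}  () W)

  attach-far : ∀ {a b L} → a ≢ b → InnerWalk s H (a ↑ˡ _) (b ↑ˡ _) L → δ ≤ L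
  attach-far {a} {b} a≢b iw = attachments-far a≢b
    (subst₂ (λ l l′ → LWalk l l′ _) (label-vertex (attachment a)) (label-vertex (attachment b))
            (label-walk (inner-walk iw)))

  Attachment : Label → Set
  Attachment l = ∃ λ a → l ≡ attachment a

  Inner : Side → Label → Set
  Inner σ l = ∃ λ j → l ≡ inner σ j

  inner? : ∀ σ l → Dec (Inner σ l)
  inner? σ     (attachment a)  = no λ { (_ , ()) }
  inner? left  (inner left j)  = yes (j , refl)
  inner? right (inner right j) = yes (j , refl)
  inner? left  (inner right j) = no λ { (_ , ()) }
  inner? right (inner left j)  = no λ { (_ , ()) }

  inner-side : ∀ {σ τ j j′} → inner σ j ≡ inner τ j′ → σ ≡ τ
  inner-side refl = refl

  same-side : ∀ {σ τ j j′} → adjL (inner σ j) (inner τ j′) ≡ true → σ ≡ τ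
  same-side {left}  {left}  _  = refl
  same-side {right} {right} _  = refl
  same-side {left}  {right} ()
  same-side {right} {left}  ()

  Within : Side → Label → Set
  Within σ l = Attachment l ⊎ Inner σ l

  within : ∀ σ l → ¬ Inner (other σ) l → Within σ l
  within σ     (attachment a)  _     = inj₁ (a , refl)
  within left  (inner left j)  _     = inj₂ (j , refl)
  within right (inner right j) _     = inj₂ (j , refl)
  within left  (inner right j) ¬other = ⊥-elim (¬other (j , refl))
  within right (inner left j)  ¬other = ⊥-elim (¬other (j , refl))

  project : ∀ σ {l} → Within σ l → Fin (s + m σ)
  project σ (inj₁ (a , _)) = a ↑ˡ m σ
  project σ (inj₂ (j , _)) = s ↑ʳ j

  project-injective : ∀ σ {l l′} (p : Within σ l) (p′ : Within σ l′) → project σ p ≡ project σ p′ → l ≡ l′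
  project-injective σ (inj₁ (a , refl)) (inj₁ (b , refl))  same = cong attachment (↑ˡ-injective _ a b same)
  project-injective σ (inj₁ (a , refl)) (inj₂ (j , refl))  same = ⊥-elim (↑ˡ≢↑ʳ same)
  project-injective σ (inj₂ (j , refl)) (inj₁ (a , refl))  same = ⊥-elim (↑ˡ≢↑ʳ (sym same))
  project-injective σ (inj₂ (j , refl)) (inj₂ (j′ , refl)) same = cong (inner σ) (↑ʳ-injective s j j′ same)

  project-adj : ∀ σ {l l′} (p : Within σ l) (p′ : Within σ l′) → adjL l l′ ≡ true →
                Adj (Q σ) (project σ p) (project σ p′)
  project-adj σ     (inj₁ (a , refl)) (inj₁ (b , refl))  ()
  project-adj σ     (inj₁ (a , refl)) (inj₂ (j , refl))  e = e
  project-adj σ     (inj₂ (j , refl)) (inj₁ (a , refl))  e = e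
  project-adj left  (inj₂ (j , refl)) (inj₂ (j′ , refl)) e = e
  project-adj right (inj₂ (j , refl)) (inj₂ (j′ , refl)) e = e

  one-sided-cycle : ∀ σ {ℓ} (C : Cycle H ℓ) → (∀ i → ¬ Inner (other σ) (label (vertices H C i))) →
                    Cycle (Q σ) ℓ
  one-sided-cycle σ C ¬other = restrict-cycle {G = H} {Q σ} {P = Within σ ∘ label} (project σ)
    (λ p p′ → label-injective ∘ project-injective σ p p′) (project-adj σ) C (λ i → within σ _ (¬other i))

  -- A cycle meeting both sides passes through two distinct attachments,
  -- and each of its two arcs between them has length at least δ.
  module TwoSided {ℓ′} (C : Cycle H (suc ℓ′)) where
    open Unrolled H C

    ℓ : ℕ
    ℓ = suc ℓ′

    lab : ℕ → Label
    lab t = label (at t)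

    stay-or-attach : ∀ {σ t} → Inner σ (lab t) → ∀ d →
                     Inner σ (lab (d + t)) ⊎ ∃ λ x → t < x × x ≤ d + t × Attachment (lab x)
    stay-or-attach in-σ zero = inj₁ in-σ
    stay-or-attach {σ} {t} in-σ (suc d) with stay-or-attach in-σ d
    ... | inj₂ (x , t<x , x≤ , att) = inj₂ (x , t<x , m≤n⇒m≤1+n x≤ , att)
    ... | inj₁ (j , lab≡) with lab (suc (d + t)) in lab′≡ | at-adj (d + t)
    ...   | attachment c | _ = inj₂ (suc (d + t) , s≤s (m≤n+m t d) , ≤-refl , c , lab′≡)
    ...   | inner τ j′   | e with same-side {σ} {τ} (subst (λ l → adjL l (inner τ j′) ≡ true) lab≡ e)
    ...     | refl = inj₁ (j′ , refl)

    crossing : ∀ {σ τ t u} → σ ≢ τ → Inner σ (lab t) → Inner τ (lab u) → t ≤ u →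
               ∃ λ x → t < x × x ≤ u × Attachment (lab x)
    crossing {t = t} {u} σ≢τ in-σ (j′ , lab-u≡) t≤u with stay-or-attach in-σ (u ∸ t)
    ... | inj₂ (x , t<x , x≤ , att) = x , t<x , subst (x ≤_) (m∸n+n≡m t≤u) x≤ , att
    ... | inj₁ (j , lab≡) =
      ⊥-elim (σ≢τ (inner-side (trans (sym lab≡) (trans (cong lab (m∸n+n≡m t≤u)) lab-u≡))))

    two-attachments : ∀ {x₁ x₂} → x₁ < x₂ → x₂ < x₁ + ℓ → Attachment (lab x₁) → Attachment (lab x₂) →
                      δ + δ ≤ ℓ
    two-attachments {x₁} {x₂} x₁<x₂ x₂<x₁+ℓ (a , lab₁) (b , lab₂) =
      subst (δ + δ ≤_) (arcs-sum (<⇒≤ x₁<x₂) (<⇒≤ x₂<x₁+ℓ))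
            (+-mono-≤ (attachments-far a≢b W₁) (attachments-far (a≢b ∘ sym) W₂))
      where
      a≢b : a ≢ b
      a≢b refl = at-injective x₁<x₂ x₂<x₁+ℓ (label-injective (trans lab₁ (sym lab₂)))
      W₁ : LWalk (attachment a) (attachment b) (x₂ ∸ x₁)
      W₁ = subst₂ (λ l l′ → LWalk l l′ (x₂ ∸ x₁)) lab₁ lab₂ (label-walk (arc (<⇒≤ x₁<x₂)))
      W₂ : LWalk (attachment b) (attachment a) (x₁ + ℓ ∸ x₂)
      W₂ = subst₂ (λ l l′ → LWalk l l′ (x₁ + ℓ ∸ x₂)) lab₂ (trans (cong label (at-periodic x₁)) lab₁)
                  (label-walk (arc (<⇒≤ x₂<x₁+ℓ)))

    opposite-inners : ∀ {t b} → t ≤ b → b ≤ t + ℓ → Inner left (lab t) → Inner right (lab b) → δ + δ ≤ ℓ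
    opposite-inners {t} t≤b b≤t+ℓ in-t in-b
      with crossing (λ ()) in-t in-b t≤b
         | crossing (λ ()) in-b (subst (Inner left ∘ label) (sym (at-periodic t)) in-t) b≤t+ℓ
    ... | x₁ , t<x₁ , x₁≤b , att₁ | x₂ , b<x₂ , x₂≤t+ℓ , att₂ =
      two-attachments (≤-<-trans x₁≤b b<x₂) (≤-<-trans x₂≤t+ℓ (+-monoˡ-< ℓ t<x₁)) att₁ att₂

    inner-at : ∀ {σ} i → Inner σ (label (vertices H C i)) → Inner σ (lab (toℕ i))
    inner-at {σ} i = subst (Inner σ ∘ label) (sym (at-toℕ i))

    both-sides : ∀ i₁ i₂ → Inner left (label (vertices H C i₁)) → Inner right (label (vertices H C i₂)) →
                 δ + δ ≤ ℓ
    both-sides i₁ i₂ in₁ in₂ with toℕ i₁ ≤? toℕ i₂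
    ... | yes t₁≤t₂ =
      opposite-inners t₁≤t₂ (≤-trans (<⇒≤ (toℕ<n i₂)) (m≤n+m ℓ (toℕ i₁))) (inner-at i₁ in₁) (inner-at i₂ in₂)
    ... | no  t₁≰t₂ =
      opposite-inners (≤-trans (<⇒≤ (toℕ<n i₁)) (m≤n+m ℓ (toℕ i₂))) (+-monoˡ-≤ ℓ (<⇒≤ (≰⇒> t₁≰t₂)))
        (inner-at i₁ in₁) (subst (Inner right ∘ label) (sym (at-periodic (toℕ i₂))) (inner-at i₂ in₂))

  girth : GirthAtLeast H g
  girth zero    _   (() , _)
  girth (suc ℓ′) ℓ<g C with any? (λ i → inner? left (label (vertices H C i)))
                          | any? (λ i → inner? right (label (vertices H C i)))
  ... | yes (i₁ , in₁) | yes (i₂ , in₂) = <⇒≱ ℓ<g (≤-trans g≤δ+δ (TwoSided.both-sides C i₁ i₂ in₁ in₂))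
  ... | _              | no ¬right      = Piece.girth P₁ _ ℓ<g (one-sided-cycle left C λ i in-r → ¬right (i , in-r))
  ... | no ¬left       | _              = Piece.girth P₂ _ ℓ<g (one-sided-cycle right C λ i in-l → ¬left (i , in-l))

  glued : Piece s r g δ
  glued = record
    { inner              = m left + m right
    ; graph              = H
    ; attachDeg          = Piece.attachDeg P₁ + Piece.attachDeg P₂
    ; attach-independent = λ a b → adj-vertex (attachment a) (attachment b)
    ; deg-attach         = deg-attachment
    ; deg-inner          = deg-inner
    ; girth              = girth
    ; attach-far         = attach-far
    }

  from-split : ∀ {u} → Split {s} {m left} u → Label
  from-split (attach a) = attachment a
  from-split (inside j) = inner left j

  from-left : Fin (s + m left) → Fin N
  from-left u = vertex (from-split (split u))

  from-left-hom : Hom (Q left) H from-left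
  from-left-hom {u} {v} e with split {s} {m left} u | split {s} {m left} v
  ... | attach a | attach b = ⊥-elim (true≢false (trans (sym e) (Piece.attach-independent P₁ a b)))
  ... | attach a | inside j = trans (adj-vertex (attachment a) (inner left j)) e
  ... | inside j | attach a = trans (adj-vertex (inner left j) (attachment a)) e
  ... | inside j | inside j′ = trans (adj-vertex (inner left j) (inner left j′)) e

  from-left-injective : Injective _≡_ _≡_ from-left
  from-left-injective {u} {v} same with split {s} {m left} u | split {s} {m left} v
                                     | trans (sym (label-vertex (from-split (split u))))
                                         (trans (cong label same) (label-vertex (from-split (split v))))
  ... | attach a | attach b   | refl = refl
  ... | attach a | inside j   | ()
  ... | inside j | attach a   | ()
  ... | inside j | inside j′  | refl = refl

  cycle-left : ∀ {ℓ} → Cycle (Q left) ℓ → Cycle H ℓ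
  cycle-left = map-cycle {G = Q left} {H} from-left-injective from-left-hom

module AttachedAt {n s r g δ} (G : Graph n) (z : Fin s → Fin n) (z-injective : Injective _≡_ _≡_ z)
    (z-independent : ∀ a b → adj G (z a) (z b) ≡ false) (d : ℕ) (deg-z : ∀ a → deg G (z a) ≡ d)
    (deg-other : ∀ v → (∀ a → z a ≢ v) → deg G v ≡ r) (girth : GirthAtLeast G g)
    (z-far : ∀ {a b L} → a ≢ b → Walk G (z a) (z b) L → δ ≤ L) where

  inner : ℕ
  inner = proj₁ (extend z z-injective)

  π : Permutation (s + inner) n
  π = proj₁ (proj₂ (extend z z-injective))

  π-attach : ∀ a → π ⟨$⟩ʳ (a ↑ˡ inner) ≡ z a
  π-attach = proj₂ (proj₂ (extend z z-injective))

  size : s + inner ≡ n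
  size = Perm.↔⇒≡ π

  inner≡ : inner ≡ n ∸ s
  inner≡ = trans (sym (m+n∸m≡n s inner)) (cong (_∸ s) size)

  π-inside : ∀ j a → z a ≢ π ⟨$⟩ʳ (s ↑ʳ j)
  π-inside j a same = ↑ˡ≢↑ʳ (permutation-injective π (trans (π-attach a) same))

  piece : Piece s r g δ
  piece = record
    { inner              = inner
    ; graph              = relabel π G
    ; attachDeg          = d
    ; attach-independent = λ a b →
        subst₂ (λ u v → adj G u v ≡ false) (sym (π-attach a)) (sym (π-attach b)) (z-independent a b)
    ; deg-attach         = λ a → trans (deg-relabel π G (a ↑ˡ inner)) (trans (cong (deg G) (π-attach a)) (deg-z a))
    ; deg-inner          = λ j → trans (deg-relabel π G (s ↑ʳ j)) (deg-other _ (π-inside j))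
    ; girth              = girth-pullback {G = relabel π G} {G} (permutation-injective π) (relabel-hom π G) girth
    ; attach-far         = λ {a} {b} a≢b iw → z-far a≢b
        (subst₂ (λ u v → Walk G u v _) (π-attach a) (π-attach b) (map-walk (relabel-hom π G) (inner-walk iw)))
    }

  cycle : ∀ {ℓ} → Cycle G ℓ → Cycle (relabel π G) ℓ
  cycle = map-cycle {G = G} {relabel π G} (permutation-injective (Perm.flip π)) (relabel-hom⁻¹ π G)

⟦yes⟧ : ∀ {P : Set} (P? : Dec P) → P → ⟦ ⌊ P? ⌋ ⟧ ≡ 1
⟦yes⟧ (yes _) _ = refl
⟦yes⟧ (no ¬p) p = ⊥-elim (¬p p)

⟦no⟧ : ∀ {P : Set} (P? : Dec P) → ¬ P → ⟦ ⌊ P? ⌋ ⟧ ≡ 0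
⟦no⟧ (yes p) ¬p = ⊥-elim (¬p p)
⟦no⟧ (no _)  _  = refl

⌊⌋-true : ∀ {P : Set} (P? : Dec P) → ⌊ P? ⌋ ≡ true → P
⌊⌋-true (yes p) _ = p

⟦∧not⟧ : ∀ b c → (c ≡ true → b ≡ true) → ⟦ b ∧ not c ⟧ + ⟦ c ⟧ ≡ ⟦ b ⟧
⟦∧not⟧ b     true  c⇒b rewrite c⇒b refl = refl
⟦∧not⟧ true  false _   = refl
⟦∧not⟧ false false _   = refl

-- Deleting a matching

-- Fin (q + q) indexes the ends of q pairs: i ↑ˡ q and q ↑ʳ i are the two ends of pair i.
module Halves (q : ℕ) where

  halves : ∀ {A : Set} → (Fin q → A) → (Fin q → A) → Fin (q + q) → A
  halves L R a = [ L , R ]′ (splitAt q a)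

  mate : Fin (q + q) → Fin (q + q)
  mate a = join q q (swap (splitAt q a))

  pair : Fin (q + q) → Fin q
  pair a = reduce (splitAt q a)

  mate-involutive : ∀ a → mate (mate a) ≡ a
  mate-involutive a = begin
    join q q (swap (splitAt q (join q q (swap (splitAt q a)))))
      ≡⟨ cong (join q q ∘ swap) (splitAt-join q q (swap (splitAt q a))) ⟩
    join q q (swap (swap (splitAt q a)))                        ≡⟨ cong (join q q) (swap-involutive (splitAt q a)) ⟩
    join q q (splitAt q a)                                      ≡⟨ join-splitAt q q a ⟩
    a                                                           ∎
    where open ≡-Reasoning

  same-pair : ∀ a b → pair a ≡ pair b → a ≢ b → b ≡ mate a
  same-pair a b same a≢b with split {q} {q} a | split {q} {q} b
  ... | attach i | attach j rewrite splitAt-↑ˡ q i q | splitAt-↑ˡ q j q = ⊥-elim (a≢b (cong (_↑ˡ q) same))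
  ... | attach i | inside j rewrite splitAt-↑ˡ q i q | splitAt-↑ʳ q q j = cong (q ↑ʳ_) (sym same)
  ... | inside i | attach j rewrite splitAt-↑ʳ q q i | splitAt-↑ˡ q j q = cong (_↑ˡ q) (sym same)
  ... | inside i | inside j rewrite splitAt-↑ʳ q q i | splitAt-↑ʳ q q j = ⊥-elim (a≢b (cong (q ↑ʳ_) same))

  halves-mate-adj : ∀ {n} (G : Graph n) {L R : Fin q → Fin n} → (∀ i → Adj G (L i) (R i)) →
                    ∀ a → Adj G (halves L R a) (halves L R (mate a))
  halves-mate-adj G L-R a with split {q} {q} a
  ... | attach i rewrite splitAt-↑ˡ q i q | splitAt-↑ʳ q q i = L-R i
  ... | inside i rewrite splitAt-↑ʳ q q i | splitAt-↑ˡ q i q = trans (adj-sym G _ _) (L-R i)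

  halves-injective : ∀ {n} (G : Graph n) (z : Fin (q + q) → Fin n) → (∀ a → Adj G (z a) (z (mate a))) →
                     (∀ a b → pair a ≢ pair b → z a ≢ z b) → Injective _≡_ _≡_ z
  halves-injective G z z-mate z-distinct {a} {b} za≡zb with a ≟ᶠ b
  ... | yes a≡b = a≡b
  ... | no  a≢b with pair a ≟ᶠ pair b
  ...   | no  pa≢pb = ⊥-elim (z-distinct a b pa≢pb za≡zb)
  ...   | yes pa≡pb = true≢false (trans (sym (z-mate a)) (trans (cong (adj G (z a) ∘ z) (sym (same-pair a b pa≡pb a≢b)))
                                                           (trans (cong (adj G (z a)) (sym za≡zb)) (loopless G (z a)))))

module WithoutMatching {n} (G : Graph n) (q : ℕ) (z : Fin (q + q) → Fin n) (z-injective : Injective _≡_ _≡_ z)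
                       (z-mate : ∀ a → Adj G (z a) (z (Halves.mate q a))) where

  open Halves q

  Matched : Fin n → Fin n → Set
  Matched u v = ∃ λ a → z a ≡ u × z (mate a) ≡ v

  matched? : ∀ u v → Dec (Matched u v)
  matched? u v = any? λ a → (z a ≟ᶠ u) ×-dec (z (mate a) ≟ᶠ v)

  matched-sym : ∀ {u v} → Matched u v → Matched v u
  matched-sym (a , refl , refl) = mate a , refl , cong z (mate-involutive a)

  matched-unique : ∀ {a v} → Matched (z a) v → v ≡ z (mate a)
  matched-unique (a′ , za′≡za , refl) = cong (z ∘ mate) (z-injective za′≡za)

  isMatched : Fin n → Fin n → Bool
  isMatched u v = ⌊ matched? u v ⌋

  isMatched-sym : ∀ u v → isMatched u v ≡ isMatched v u
  isMatched-sym u v with matched? u v | matched? v u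
  ... | yes _  | yes _  = refl
  ... | no _   | no _   = refl
  ... | yes uv | no ¬vu = ⊥-elim (¬vu (matched-sym uv))
  ... | no ¬uv | yes vu = ⊥-elim (¬uv (matched-sym vu))

  isMatched⇒adj : ∀ u v → isMatched u v ≡ true → adj G u v ≡ true
  isMatched⇒adj u v m with matched? u v
  ... | yes (a , refl , refl) = z-mate a

  G∖M : Graph n
  G∖M = record
    { adj      = λ u v → adj G u v ∧ not (isMatched u v)
    ; adj-sym  = λ u v → cong₂ (λ b c → b ∧ not c) (adj-sym G u v) (isMatched-sym u v)
    ; loopless = λ v → cong (λ b → b ∧ not (isMatched v v)) (loopless G v)
    }

  G∖M⊆G : Hom G∖M G (λ v → v)
  G∖M⊆G {u} {v} e with adj G u v
  ... | true = refl

  mate-removed : ∀ a → adj G∖M (z a) (z (mate a)) ≡ false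
  mate-removed a with matched? (z a) (z (mate a))
  ... | yes _ = ∧-zeroʳ (adj G (z a) (z (mate a)))
  ... | no ¬m = ⊥-elim (¬m (a , refl , refl))

  occurrences : ∀ a → ∑[ b < q + q ] ⟦ ⌊ z b ≟ᶠ z a ⌋ ⟧ ≡ 1
  occurrences a = ∑-single _ a (⟦yes⟧ (z a ≟ᶠ z a) refl) (λ b b≢a → ⟦no⟧ (z b ≟ᶠ z a) (b≢a ∘ z-injective))

  matched-count : ∀ v → ∑[ w < n ] ⟦ isMatched v w ⟧ ≡ ∑[ a < q + q ] ⟦ ⌊ z a ≟ᶠ v ⌋ ⟧
  matched-count v with any? (λ a → z a ≟ᶠ v)
  ... | yes (a , refl) = trans (∑-single _ (z (mate a)) (⟦yes⟧ (matched? (z a) (z (mate a))) (a , refl , refl))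
                                         (λ w w≢ → ⟦no⟧ (matched? (z a) w) (w≢ ∘ matched-unique)))
                               (sym (occurrences a))
  ... | no ¬z = trans (∑-zero n (λ w → ⟦no⟧ (matched? v w) (λ (a , za≡v , _) → ¬z (a , za≡v))))
                      (sym (∑-zero (q + q) (λ a → ⟦no⟧ (z a ≟ᶠ v) (λ za≡v → ¬z (a , za≡v)))))

  deg-without : ∀ v → ∑[ a < q + q ] ⟦ ⌊ z a ≟ᶠ v ⌋ ⟧ + deg G∖M v ≡ deg G v
  deg-without v = begin
    ∑[ a < q + q ] ⟦ ⌊ z a ≟ᶠ v ⌋ ⟧ + deg G∖M v
      ≡⟨ +-comm _ (deg G∖M v) ⟩
    deg G∖M v + ∑[ a < q + q ] ⟦ ⌊ z a ≟ᶠ v ⌋ ⟧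
      ≡⟨ cong₂ _+_ (sym (deg-∑ G∖M v)) (matched-count v) ⟨
    ∑[ w < n ] ⟦ adj G∖M v w ⟧ + ∑[ w < n ] ⟦ isMatched v w ⟧
      ≡⟨ ∑-distrib-+ (λ w → ⟦ adj G∖M v w ⟧) (λ w → ⟦ isMatched v w ⟧) ⟨
    ∑[ w < n ] (⟦ adj G∖M v w ⟧ + ⟦ isMatched v w ⟧)
      ≡⟨ sum-cong-≗ {n} (λ w → ⟦∧not⟧ (adj G v w) (isMatched v w) (isMatched⇒adj v w)) ⟩
    ∑[ w < n ] ⟦ adj G v w ⟧
      ≡⟨ deg-∑ G v ⟨
    deg G v ∎
    where open ≡-Reasoning

  deg-without-matched : ∀ a → suc (deg G∖M (z a)) ≡ deg G (z a)
  deg-without-matched a = trans (cong (_+ deg G∖M (z a)) (sym (occurrences a))) (deg-without (z a))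

  deg-without-unmatched : ∀ v → (∀ a → z a ≢ v) → deg G∖M v ≡ deg G v
  deg-without-unmatched v ¬z =
    trans (cong (_+ deg G∖M v) (sym (∑-zero (q + q) (λ a → ⟦no⟧ (z a ≟ᶠ v) (¬z a))))) (deg-without v)

  girth-without : ∀ {g} → GirthAtLeast G g → GirthAtLeast G∖M g
  girth-without = girth-pullback {G = G∖M} {G} (λ same → same) G∖M⊆G

  mates-far : ∀ {g} → GirthAtLeast G g → ∀ a {L} → Walk G∖M (z a) (z (mate a)) L → g ≤ suc L
  mates-far girth a = Bypass.bypass-long {G = G} {G∖M} girth G∖M⊆G (z-mate a) (mate-removed a)

-- Pieces from an (r,g)-graph

⌈g/2⌉<g : ∀ g → 2 ≤ g → ⌈ g /2⌉ < g
⌈g/2⌉<g (suc (suc g)) _         = ⌈n/2⌉<n g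
⌈g/2⌉<g (suc zero)    (s≤s ())

g≤⌈g/2⌉+⌈g/2⌉ : ∀ g → g ≤ ⌈ g /2⌉ + ⌈ g /2⌉
g≤⌈g/2⌉+⌈g/2⌉ g =
  subst (_≤ ⌈ g /2⌉ + ⌈ g /2⌉) (⌊n/2⌋+⌈n/2⌉≡n g) (+-monoˡ-≤ ⌈ g /2⌉ (⌊n/2⌋≤⌈n/2⌉ g))

module PiecesOf {r g n} (G : Graph n) (regular : Regular G r) (girth : GirthAtLeast G g) (5≤g : 5 ≤ g) where

  δ : ℕ
  δ = ⌈ g /2⌉

  3≤δ : 3 ≤ δ
  3≤δ = ⌈n/2⌉-mono 5≤g

  δ<g : δ < g
  δ<g = ⌈g/2⌉<g g (≤-trans (s≤s (s≤s z≤n)) 5≤g)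

  Spread : ∀ {s} → (Fin s → Fin n) → Set
  Spread f = ∀ a b → a ≢ b → DistAtLeast G (f a) (f b) δ

  module VertexPiece {s} (f : Fin s → Fin n) (f-spread : Spread f) where

    f-injective : Injective _≡_ _≡_ f
    f-injective {a} {b} same with a ≟ᶠ b
    ... | yes a≡b = a≡b
    ... | no  a≢b = ⊥-elim (dist⇒≢ (≤-trans (s≤s z≤n) 3≤δ) (f-spread a b a≢b) same)

    f-independent : ∀ a b → adj G (f a) (f b) ≡ false
    f-independent a b with a ≟ᶠ b
    ... | yes refl = loopless G (f a)
    ... | no  a≢b  = dist⇒nonadjacent (≤-trans (s≤s (s≤s z≤n)) 3≤δ) (f-spread a b a≢b)

    open AttachedAt G f f-injective f-independent r (λ a → regular (f a)) (λ v _ → regular v) girth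
                    (λ a≢b → dist-walk (f-spread _ _ a≢b)) public

  module EdgePiece {q} (e : Fin q → Fin n × Fin n) (e-adj : ∀ i → Adj G (proj₁ (e i)) (proj₂ (e i)))
                   (e-spread : ∀ i j → i ≢ j → EdgeDistAtLeast G (e i) (e j) δ) where

    open Halves q

    z : Fin (q + q) → Fin n
    z = halves (proj₁ ∘ e) (proj₂ ∘ e)

    z-far : ∀ a b → pair a ≢ pair b → DistAtLeast G (z a) (z b) δ
    z-far a b with split {q} {q} a | split {q} {q} b
    ... | attach i | attach j rewrite splitAt-↑ˡ q i q | splitAt-↑ˡ q j q = λ i≢j → proj₁ (e-spread i j i≢j)
    ... | attach i | inside j rewrite splitAt-↑ˡ q i q | splitAt-↑ʳ q q j = λ i≢j → proj₁ (proj₂ (e-spread i j i≢j))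
    ... | inside i | attach j rewrite splitAt-↑ʳ q q i | splitAt-↑ˡ q j q = λ i≢j → proj₁ (proj₂ (proj₂ (e-spread i j i≢j)))
    ... | inside i | inside j rewrite splitAt-↑ʳ q q i | splitAt-↑ʳ q q j = λ i≢j → proj₂ (proj₂ (proj₂ (e-spread i j i≢j)))

    z-mate : ∀ a → Adj G (z a) (z (mate a))
    z-mate = halves-mate-adj G e-adj

    z-injective : Injective _≡_ _≡_ z
    z-injective = halves-injective G z z-mate (λ a b pa≢pb → dist⇒≢ (≤-trans (s≤s z≤n) 3≤δ) (z-far a b pa≢pb))

    open WithoutMatching G q z z-injective z-mate

    z-independent : ∀ a b → adj G∖M (z a) (z b) ≡ false
    z-independent a b with a ≟ᶠ b | pair a ≟ᶠ pair b
    ... | yes refl | _         = loopless G∖M (z a)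
    ... | no  a≢b  | yes pa≡pb =
      subst (λ c → adj G∖M (z a) (z c) ≡ false) (sym (same-pair a b pa≡pb a≢b)) (mate-removed a)
    ... | no  _    | no  pa≢pb =
      cong (λ x → x ∧ not (isMatched (z a) (z b))) (dist⇒nonadjacent (≤-trans (s≤s (s≤s z≤n)) 3≤δ) (z-far a b pa≢pb))

    z-far-without : ∀ {a b L} → a ≢ b → Walk G∖M (z a) (z b) L → δ ≤ L
    z-far-without {a} {b} a≢b W with pair a ≟ᶠ pair b
    ... | yes pa≡pb =
      ≤-pred (≤-trans δ<g (mates-far girth a (subst (λ c → Walk G∖M (z a) (z c) _) (same-pair a b pa≡pb a≢b) W)))
    ... | no  pa≢pb = dist-walk (z-far a b pa≢pb) (map-walk G∖M⊆G W)

    open AttachedAt G∖M z z-injective z-independent (r ∸ 1)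
                    (λ a → cong (_∸ 1) (trans (deg-without-matched a) (regular (z a))))
                    (λ v ¬z → trans (deg-without-unmatched v ¬z) (regular v))
                    (girth-without girth) z-far-without public

  module PendantPiece {q} (r≢0 : r ≢ 0) (f : Fin (q + q) → Fin n) (f-spread : Spread f) where

    open Halves q

    s : ℕ
    s = q + q

    y : Fin q → Fin n
    y i = f (i ↑ˡ q)

    y-far : ∀ {i j} → i ≢ j → DistAtLeast G (y i) (y j) δ
    y-far {i} {j} i≢j = f-spread _ _ (i≢j ∘ ↑ˡ-injective q i j)

    u : Fin q → Fin n
    u i = proj₁ (neighbour G (y i) (r≢0 ∘ trans (sym (regular (y i)))))

    y-u : ∀ i → Adj G (y i) (u i)
    y-u i = proj₂ (neighbour G (y i) (r≢0 ∘ trans (sym (regular (y i)))))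

    z : Fin s → Fin n
    z = halves y u

    centre-near : ∀ a → ∃ λ k → k ≤ 1 × Walk G (y (pair a)) (z a) k × Walk G (z a) (y (pair a)) k
    centre-near a with split {q} {q} a
    ... | attach i rewrite splitAt-↑ˡ q i q = 0 , z≤n , here , here
    ... | inside i rewrite splitAt-↑ʳ q q i = 1 , ≤-refl , step (y-u i) here , step (trans (adj-sym G _ _) (y-u i)) here

    z-far : ∀ a b → pair a ≢ pair b → ∀ {L} → Walk G (z a) (z b) L → δ ≤ 2 + L
    z-far a b pa≢pb {L} W with centre-near a | centre-near b
    ... | k , k≤1 , to-a , _ | k′ , k′≤1 , _ , from-b =
      ≤-trans (dist-walk (y-far pa≢pb) (to-a ++ʷ W ++ʷ from-b))
              (subst (k + (L + k′) ≤_) (cong suc (+-comm L 1)) (+-mono-≤ k≤1 (+-monoʳ-≤ L k′≤1)))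

    z-mate : ∀ a → Adj G (z a) (z (mate a))
    z-mate = halves-mate-adj G y-u

    z-injective : Injective _≡_ _≡_ z
    z-injective = halves-injective G z z-mate
      (λ a b pa≢pb same → ≤⇒≯ (z-far a b pa≢pb (subst (λ v → Walk G (z a) v 0) same here)) 3≤δ)

    open WithoutMatching G q z z-injective z-mate

    data Label : Set where
      pendant : Fin s → Label
      old     : Fin n → Label

    label : Fin (s + n) → Label
    label x = [ pendant , old ]′ (splitAt s x)

    label-pendant : ∀ a → label (a ↑ˡ n) ≡ pendant a
    label-pendant a rewrite splitAt-↑ˡ s a n = refl

    label-old : ∀ v → label (s ↑ʳ v) ≡ old v
    label-old v rewrite splitAt-↑ʳ s n v = refl

    label-injective : Injective _≡_ _≡_ label
    label-injective {x} {x′} same with split {s} {n} x | split {s} {n} x′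
    ... | attach a | attach b with trans (sym (label-pendant a)) (trans same (label-pendant b))
    ...   | refl = refl
    label-injective same | attach a | inside v with trans (sym (label-pendant a)) (trans same (label-old v))
    ...   | ()
    label-injective same | inside v | attach a with trans (sym (label-old v)) (trans same (label-pendant a))
    ...   | ()
    label-injective same | inside v | inside w with trans (sym (label-old v)) (trans same (label-old w))
    ...   | refl = refl

    adjL : Label → Label → Bool
    adjL (pendant a) (pendant b) = false
    adjL (pendant a) (old v)     = ⌊ z a ≟ᶠ v ⌋
    adjL (old v)     (pendant a) = ⌊ z a ≟ᶠ v ⌋
    adjL (old v)     (old w)     = adj G∖M v w

    adjL-sym : ∀ x x′ → adjL x x′ ≡ adjL x′ x
    adjL-sym (pendant a) (pendant b) = refl
    adjL-sym (pendant a) (old v)     = refl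
    adjL-sym (old v)     (pendant a) = refl
    adjL-sym (old v)     (old w)     = adj-sym G∖M v w

    adjL-irrefl : ∀ x → adjL x x ≡ false
    adjL-irrefl (pendant a) = refl
    adjL-irrefl (old v)     = loopless G∖M v

    B : Graph (s + n)
    B = record
      { adj      = λ x x′ → adjL (label x) (label x′)
      ; adj-sym  = λ x x′ → adjL-sym (label x) (label x′)
      ; loopless = λ x → adjL-irrefl (label x)
      }

    adj-label : ∀ {x x′ l l′} → label x ≡ l → label x′ ≡ l′ → adj B x x′ ≡ adjL l l′
    adj-label refl refl = refl

    deg-pendant : ∀ a → deg B (a ↑ˡ n) ≡ 1
    deg-pendant a = begin
      deg B (a ↑ˡ n)
        ≡⟨ deg-split {s} B (a ↑ˡ n) ⟩
      ∑[ b < s ] ⟦ adj B (a ↑ˡ n) (b ↑ˡ n) ⟧ + ∑[ v < n ] ⟦ adj B (a ↑ˡ n) (s ↑ʳ v) ⟧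
        ≡⟨ cong₂ _+_ (∑-zero s (λ b → cong ⟦_⟧ (adj-label (label-pendant a) (label-pendant b))))
                     (sum-cong-≗ {n} (λ v → cong ⟦_⟧ (adj-label (label-pendant a) (label-old v)))) ⟩
      ∑[ v < n ] ⟦ ⌊ z a ≟ᶠ v ⌋ ⟧
        ≡⟨ ∑-single _ (z a) (⟦yes⟧ (z a ≟ᶠ z a) refl) (λ v v≢za → ⟦no⟧ (z a ≟ᶠ v) (v≢za ∘ sym)) ⟩
      1 ∎
      where open ≡-Reasoning

    deg-old : ∀ v → deg B (s ↑ʳ v) ≡ r
    deg-old v = begin
      deg B (s ↑ʳ v)
        ≡⟨ deg-split {s} B (s ↑ʳ v) ⟩
      ∑[ a < s ] ⟦ adj B (s ↑ʳ v) (a ↑ˡ n) ⟧ + ∑[ w < n ] ⟦ adj B (s ↑ʳ v) (s ↑ʳ w) ⟧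
        ≡⟨ cong₂ _+_ (sum-cong-≗ {s} (λ a → cong ⟦_⟧ (adj-label (label-old v) (label-pendant a))))
                     (trans (sum-cong-≗ {n} (λ w → cong ⟦_⟧ (adj-label (label-old v) (label-old w))))
                            (sym (deg-∑ G∖M v))) ⟩
      ∑[ a < s ] ⟦ ⌊ z a ≟ᶠ v ⌋ ⟧ + deg G∖M v
        ≡⟨ deg-without v ⟩
      deg G v
        ≡⟨ regular v ⟩
      r ∎
      where open ≡-Reasoning

    pendant-neighbour : ∀ {a l} → adjL (pendant a) l ≡ true → l ≡ old (z a)
    pendant-neighbour {a} {old v} e = cong old (sym (⌊⌋-true (z a ≟ᶠ v) e))

    unique-neighbour : ∀ {x a w} → label x ≡ pendant a → Adj B x w → w ≡ s ↑ʳ z a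
    unique-neighbour {x} {a} {w} x-pendant e =
      label-injective (trans (pendant-neighbour (subst (λ l → adjL l (label w) ≡ true) x-pendant e))
                             (sym (label-old (z a))))

    IsOld : Fin (s + n) → Set
    IsOld x = ∃ λ v → label x ≡ old v

    old-or-pendant : ∀ x → ¬ (∃ λ a → label x ≡ pendant a) → IsOld x
    old-or-pendant x ¬pendant with label x
    ... | pendant a = ⊥-elim (¬pendant (a , refl))
    ... | old v     = v , refl

    pendant? : ∀ x → Dec (∃ λ a → label x ≡ pendant a)
    pendant? x with label x
    ... | pendant a = yes (a , refl)
    ... | old v     = no λ { (_ , ()) }

    girth-B : GirthAtLeast B g
    girth-B ℓ ℓ<g C with any? (λ i → pendant? (vertices B C i))
    ... | yes (i , a , is-pendant) =
      leaf-not-on-cycle B C i (λ e e′ → trans (unique-neighbour is-pendant e) (sym (unique-neighbour is-pendant e′)))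
    ... | no ¬pendant = girth-without girth ℓ ℓ<g
      (restrict-cycle {G = B} {G∖M} {P = IsOld} proj₁
        (λ (v , old-v) (w , old-w) v≡w → label-injective (trans old-v (trans (cong old v≡w) (sym old-w))))
        (λ (v , old-v) (w , old-w) e → subst₂ (λ l l′ → adjL l l′ ≡ true) old-v old-w e)
        C (λ i → old-or-pendant _ (λ is-pendant → ¬pendant (i , is-pendant))))

    old-walk : ∀ {v b L} → InnerWalk s B (s ↑ʳ v) (b ↑ˡ n) L → ∃ λ L′ → L ≡ suc L′ × Walk G∖M v (z b) L′
    old-walk {v} {b} (edge e) =
      0 , refl , subst (λ w → Walk G∖M v w 0)
                       (sym (⌊⌋-true (z b ≟ᶠ v) (trans (sym (adj-label (label-old v) (label-pendant b))) e))) here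
    old-walk {v} (via {j = w} e iw) with old-walk iw
    ... | L′ , refl , W = suc L′ , refl , step (trans (sym (adj-label (label-old v) (label-old w))) e) W

    attach-far : ∀ {a b L} → a ≢ b → InnerWalk s B (a ↑ˡ n) (b ↑ˡ n) L → δ ≤ L
    attach-far {a} {b} a≢b (edge e) = true≢false (trans (sym e) (adj-label (label-pendant a) (label-pendant b)))
    attach-far {a} {b} a≢b (via {j = v} e iw)
      with old-walk iw | ⌊⌋-true (z a ≟ᶠ v) (trans (sym (adj-label (label-pendant a) (label-old v))) e)
    ... | L′ , refl , W | refl with pair a ≟ᶠ pair b
    ...   | yes pa≡pb = ≤-trans (<⇒≤ δ<g)
                          (m≤n⇒m≤1+n (mates-far girth a
                            (subst (λ c → Walk G∖M (z a) (z c) L′) (same-pair a b pa≡pb a≢b) W)))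
    ...   | no  pa≢pb = z-far a b pa≢pb (map-walk G∖M⊆G W)

    piece : Piece s r g δ
    piece = record
      { inner              = n
      ; graph              = B
      ; attachDeg          = 1
      ; attach-independent = λ a b → adj-label (label-pendant a) (label-pendant b)
      ; deg-attach         = deg-pendant
      ; deg-inner          = deg-old
      ; girth              = girth-B
      ; attach-far         = attach-far
      }

module Copies {s r g δ} (g≤δ+δ : g ≤ δ + δ) (P : Piece s r g δ) where

  copies : ∀ k → .{{NonZero k}} → Piece s r g δ
  copies 1             = P
  copies (suc (suc k)) = Gluing.glued g≤δ+δ P (copies (suc k))

  inner-copies : ∀ k → .{{_ : NonZero k}} → Piece.inner (copies k) ≡ k * Piece.inner P
  inner-copies 1             = sym (+-identityʳ _)
  inner-copies (suc (suc k)) = cong (Piece.inner P +_) (inner-copies (suc k))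

  attachDeg-copies : ∀ k → .{{_ : NonZero k}} → Piece.attachDeg (copies k) ≡ k * Piece.attachDeg P
  attachDeg-copies 1             = sym (+-identityʳ _)
  attachDeg-copies (suc (suc k)) = cong (Piece.attachDeg P +_) (attachDeg-copies (suc k))

  cycle-copies : ∀ k → .{{_ : NonZero k}} → ∀ {ℓ} → Cycle (Piece.graph P) ℓ → Cycle (Piece.graph (copies k)) ℓ
  cycle-copies 1             C = C
  cycle-copies (suc (suc k)) C = Gluing.cycle-left g≤δ+δ P (copies (suc k)) C

exists-bireg : ∀ {s r g δ} (P : Piece s r g δ) → Fin s → Cycle (Piece.graph P) g →
               ∀ {N m} → s + Piece.inner P ≡ N → Piece.attachDeg P ≡ m → r < m → ExistsBireg r m g N
exists-bireg {s} {r} P a C refl refl r<m =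
  graph , (degrees , (s ↑ʳ j , deg-inner j) , (a ↑ˡ inner , deg-attach a)) , C , girth
  where
  open Piece P
  j : Fin inner
  j = inner-neighbour a (m<n⇒n≢0 r<m)
  degrees : ∀ v → deg graph v ≡ r ⊎ deg graph v ≡ attachDeg
  degrees v with split {s} {inner} v
  ... | attach b = inj₂ (deg-attach b)
  ... | inside j = inj₁ (deg-inner j)

data Even : ℕ → Set where
  double : ∀ q → Even (q + q)

even : ∀ {s} → 2 ∣ s → Even s
even (divides q refl) = subst Even (trans (cong (q +_) (sym (+-identityʳ q))) (*-comm 2 q)) (double q)

half-double : ∀ q → (q + q) / 2 ≡ q
half-double q = trans (cong (_/ 2) (trans (cong (q +_) (sym (+-identityʳ q))) (*-comm 2 q))) (m*n/n≡m q 2)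

module Cases {r g ng} (G : Graph ng) (regular : Regular G r) (hasGirth : HasGirth G g) (5≤g : 5 ≤ g) (2≤r : 2 ≤ r)
  where

  open PiecesOf G regular (proj₂ hasGirth) 5≤g

  g≤δ+δ : g ≤ δ + δ
  g≤δ+δ = g≤⌈g/2⌉+⌈g/2⌉ g

  degree-rk : ∀ {s} (f : Fin s → Fin ng) → Spread f → Fin s → ∀ k m → r < m → m ≡ r * suc k →
              ExistsBireg r m g (suc k * (ng ∸ s) + s)
  degree-rk {s} f f-spread a k m r<m refl =
    exists-bireg (copies (suc k)) a (cycle-copies (suc k) (cycle (proj₁ hasGirth)))
      (trans (cong (s +_) (trans (inner-copies (suc k)) (cong (suc k *_) inner≡))) (+-comm s _))
      (trans (attachDeg-copies (suc k)) (*-comm (suc k) r)) r<m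
    where
    open VertexPiece f f-spread using (piece; inner≡; cycle)
    open Copies g≤δ+δ piece

  degree-rk+1 : ∀ {s} → Even s → (f : Fin s → Fin ng) → Spread f → Fin s → ∀ k m → r < m → m ≡ r * suc k + 1 →
                ExistsBireg r m g (suc k * (ng ∸ s) + (ng + s))
  degree-rk+1 (double q) f f-spread a k m r<m refl =
    exists-bireg (Gluing.glued g≤δ+δ (copies (suc k)) pendant) a
      (Gluing.cycle-left g≤δ+δ (copies (suc k)) pendant (cycle-copies (suc k) (cycle (proj₁ hasGirth))))
      (trans (cong (λ x → q + q + (x + ng)) (trans (inner-copies (suc k)) (cong (suc k *_) inner≡)))
             (rearrange (q + q) (suc k * (ng ∸ (q + q))) ng))
      (cong (_+ 1) (trans (attachDeg-copies (suc k)) (*-comm (suc k) r))) r<m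
    where
    open VertexPiece f f-spread using (piece; inner≡; cycle)
    open Copies g≤δ+δ piece
    pendant : Piece (q + q) r g δ
    pendant = PendantPiece.piece {q} (m<n⇒n≢0 2≤r) f f-spread
    rearrange : ∀ s x n → s + (x + n) ≡ x + (n + s)
    rearrange = solve-∀

  degree-rk+l[r-1] : ∀ {s} → Even s → (f : Fin s → Fin ng) → Spread f → Fin s → HasSpreadEdges G (s / 2) δ →
                     ∀ k l m → r < m → m ≡ r * suc k + suc l * (r ∸ 1) →
                     ExistsBireg r m g (suc k * (ng ∸ s) + (ng + l * (ng ∸ s)))
  degree-rk+l[r-1] (double q) f f-spread a spread-edges k l m r<m refl =
    exists-bireg (Gluing.glued g≤δ+δ (VC.copies (suc k)) (EC.copies (suc l))) a
      (Gluing.cycle-left g≤δ+δ (VC.copies (suc k)) (EC.copies (suc l))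
        (VC.cycle-copies (suc k) (V.cycle (proj₁ hasGirth))))
      order
      (cong₂ _+_ (trans (VC.attachDeg-copies (suc k)) (*-comm (suc k) r)) (EC.attachDeg-copies (suc l))) r<m
    where
    module V = VertexPiece f f-spread
    module VC = Copies g≤δ+δ V.piece
    spread-pairs : HasSpreadEdges G q δ
    spread-pairs = subst (λ t → HasSpreadEdges G t δ) (half-double q) spread-edges
    module E = EdgePiece (proj₁ spread-pairs) (proj₁ (proj₂ spread-pairs)) (proj₂ (proj₂ spread-pairs))
    module EC = Copies g≤δ+δ E.piece
    rearrange : ∀ s x k l → s + (suc k * x + suc l * x) ≡ suc k * x + ((s + x) + l * x)
    rearrange = solve-∀
    X = ng ∸ (q + q)
    order : q + q + (Piece.inner (VC.copies (suc k)) + Piece.inner (EC.copies (suc l))) ≡ suc k * X + (ng + l * X)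
    order = begin
      q + q + (Piece.inner (VC.copies (suc k)) + Piece.inner (EC.copies (suc l)))
        ≡⟨ cong₂ (λ x y → q + q + (x + y)) (trans (VC.inner-copies (suc k)) (cong (suc k *_) V.inner≡))
                                           (trans (EC.inner-copies (suc l)) (cong (suc l *_) E.inner≡)) ⟩
      q + q + (suc k * X + suc l * X)  ≡⟨ rearrange (q + q) X k l ⟩
      suc k * X + ((q + q + X) + l * X)
        ≡⟨ cong (λ n → suc k * X + (n + l * X)) (trans (cong (q + q +_) (sym V.inner≡)) V.size) ⟩
      suc k * X + (ng + l * X)         ∎
      where open ≡-Reasoning

theorem4p2 : (r g s ng : ℕ) → 2 ≤ r → 5 ≤ g → 1 ≤ s →
    (G : Graph ng) → RGGraph G r g → HasSpreadVertices G s ⌈ g /2⌉ →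
    (k l m : ℕ) → 1 ≤ k → 1 ≤ l → r < m →
      (m ≡ r * k → ExistsBireg r m g (k * (ng ∸ s) + s))
      × (m ≡ r * k + 1 → 2 ∣ s → ExistsBireg r m g (k * (ng ∸ s) + (ng + s)))
      × (m ≡ r * k + l * (r ∸ 1) → 2 ∣ s → HasSpreadEdges G (s / 2) ⌈ g /2⌉ →
           ExistsBireg r m g (k * (ng ∸ s) + (ng + (l ∸ 1) * (ng ∸ s))))
theorem4p2 r g s ng 2≤r 5≤g 1≤s G (regular , hasGirth) (f , f-spread) (suc k) (suc l) m _ _ r<m =
    degree-rk f f-spread a k m r<m
  , (λ m≡ 2∣s → degree-rk+1 (even 2∣s) f f-spread a k m r<m m≡)
  , (λ m≡ 2∣s spread-edges → degree-rk+l[r-1] (even 2∣s) f f-spread a spread-edges k l m r<m m≡)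
  where
  open Cases G regular hasGirth 5≤g 2≤r
  a : Fin s
  a = fromℕ< 1≤s
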